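{- Let $p\geq 3$ be a prime and let $k\in[3,p]$ be an integer. Then there exists a simple cyclic $(pk,k;p)_p$ relative Heffter space.
   Context: Let $G$ be an abelian group of order $2v+t$ and $J$ a subgroup of $G$ of order $t$. A half-set of $G\setminus J$ is a subset $V\subseteq G$ of size $v$ with $V\cup(-V)=G\setminus J$. If $|G|=2nk+t$ and $V$ is a half-set of $G\setminus J$, an $(nk,k)_t$ relative Heffter system on $V$ is a partition of $V$ into parts (blocks) of size $k$, each summing to $0$ in $G$. Two such systems on the same half-set are orthogonal if every block of one meets every block of the other in at most one element. An $(nk,k;r)_t$ relative Heffter space over $G$ relative to $J$ is a set of $r$ pairwise orthogonal $(nk,k)_t$ relative Heffter systems on a common half-set $V$ of $G\setminus J$. It is cyclic if $G=\mathbb{Z}_{2nk+t}$ and $J$ is its subgroup of order $t$. A $k$-subset $B$ of $G$ is simple if its elements admit an ordering $(b_0,\dots,b_{k-1})$ whose partial sums $c_i=\sum_{j=0}^{i}b_j$, $0\le i\le k-1$, are pairwise distinct; a relative Heffter space is simple if each of its blocks is simple. Here $[a,b]=\{a,a+1,\dots,b\}$. -}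

module Defs where

open import Data.Nat using (ℕ; _+_; _*_; _<_; ∣_-_∣)
open import Data.Nat.Divisibility using (_∣_)
open import Data.List using (List; []; _∷_; length; concat)
open import Data.Nat.ListAction using (sum)
open import Data.List.Membership.Propositional using (_∈_)
open import Data.List.Relation.Unary.All using (All)
open import Data.List.Relation.Unary.Unique.Propositional using (Unique)
open import Data.List.Relation.Unary.AllPairs using (AllPairs)
open import Data.List.Relation.Binary.Permutation.Propositional using (_↭_)
open import Data.Product using (Σ; _×_; ∃)
open import Data.Sum using (_⊎_)
open import Data.Fin using (Fin)
open import Relation.Nullary using (¬_)
open import Relation.Binary.PropositionalEquality using (_≡_; _≢_)
open import Function.Bundles using (_⇔_)

-- The cyclic group Z_N is modelled by the naturals x < N, with
-- congruence modulo N:  a ≡ b (mod N)  iff  N ∣ |a - b|.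
Cong : ℕ → ℕ → ℕ → Set
Cong N a b = N ∣ ∣ a - b ∣

-- Order of the ambient group for an (nk,k)_t relative Heffter system.
order : ℕ → ℕ → ℕ → ℕ
order n k t = 2 * n * k + t

-- Membership in the (unique) subgroup J of order t of Z_N (t ∣ N):
-- J = { x : t·x ≡ 0 (mod N) }.
InJ : (N t x : ℕ) → Set
InJ N t x = N ∣ t * x

NegIn : (N : ℕ) → List ℕ → ℕ → Set
NegIn N V x = ∃ λ y → y ∈ V × (N ∣ x + y)

HalfSet : (N t v : ℕ) → List ℕ → Set
HalfSet N t v V =
  All (_< N) V × Unique V × length V ≡ v ×
  (∀ x → x < N → ((x ∈ V ⊎ NegIn N V x) ⇔ (¬ InJ N t x)))

HeffterSystem : (N k : ℕ) → List ℕ → List (List ℕ) → Set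
HeffterSystem N k V S =
  All (λ B → length B ≡ k × N ∣ sum B) S × concat S ↭ V

Orthogonal : List (List ℕ) → List (List ℕ) → Set
Orthogonal S S' =
  ∀ {B B'} → B ∈ S → B' ∈ S' →
  ∀ {x y} → x ∈ B → x ∈ B' → y ∈ B → y ∈ B' → x ≡ y

partialSums : List ℕ → List ℕ
partialSums = go 0
  where
  go : ℕ → List ℕ → List ℕ
  go acc [] = []
  go acc (b ∷ bs) = (acc + b) ∷ go (acc + b) bs

SimpleBlock : ℕ → List ℕ → Set
SimpleBlock N B =
  ∃ λ L → L ↭ B × AllPairs (λ a b → ¬ Cong N a b) (partialSums L)

SimpleCyclicRelHeffterSpace : (n k r t : ℕ) → Set
SimpleCyclicRelHeffterSpace n k r t =
  Σ (List ℕ) λ V → HalfSet (order n k t) t (n * k) V ×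
  Σ (Fin r → List (List ℕ)) λ S →
    (∀ i → HeffterSystem (order n k t) k V (S i)) ×
    (∀ i j → i ≢ j → Orthogonal (S i) (S j)) ×
    (∀ i → All (SimpleBlock (order n k t)) (S i))

-- Let m = 2k + 1, so that the ambient group is Z_(pm) and J = m Z_(pm).
--
-- A walk 0 ↗ h ↘ … that alternates direction with strictly decreasing gaps stays
-- inside (0, m) and never revisits a point. Taking the gaps h ∈ {k, k + 1}, then k − 1, …, c + 1
-- and c − 1, …, 1, arranged (according to k mod 4) so that the walk ends at c, the signed steps
-- followed by −c form a zero-sum half-set ρ_0, …, ρ_(k−1) of Z_m ∖ {0} with distinct partial sums.
--
-- Block j of system i is { ρ_t + m ((λ_t (j + t i) + δ_t) mod p) : t < k }, where
-- λ = (L, 2, …, 2, L) with L = p − (k − 2) makes Σ λ_t and Σ t λ_t vanish mod p, and δ_0 cancels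
-- Σ ρ_t. Since j ↦ λ_t (j + t i) permutes Z_p, each system partitions V = { ρ_t + a m }; blocks of
-- systems i ≠ i′ meeting in positions t ≠ u would force (t − u)(i − i′) ≡ 0 (mod p), impossible
-- as 0 < |t − u| < k ≤ p; and each block reduces to ρ modulo m, hence is simple.

module Submission where

open import Defs
open import Data.Nat using (ℕ; _≤_)
open import Data.Nat.Primality using (Prime)

open import Data.Empty using (⊥-elim)
open import Data.Fin using (toℕ)
open import Data.Fin.Properties using (toℕ<n; toℕ-injective)
open import Data.List using (List; []; _∷_; _++_; _∷ʳ_; map; length; concat; applyUpTo; applyDownFrom; filter)
open import Data.List.Properties
  using (∷-injective; length-++; length-applyUpTo; length-applyDownFrom; applyUpTo-∷ʳ; map-++; map-applyUpTo; filter-notAll; ++-identityʳ)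
open import Data.List.Membership.Propositional using (_∈_)
open import Data.List.Membership.Propositional.Properties
  using (∈-applyUpTo⁺; ∈-applyUpTo⁻; ∈-concat⁺′; ∈-concat⁻′; ∈-filter⁺; ∈-++⁺ˡ; ∈-++⁺ʳ)
open import Data.List.Membership.Propositional.Properties.WithK using (unique∧set⇒bag)
open import Data.List.Relation.Binary.BagAndSetEquality using (∼bag⇒↭)
open import Data.List.Relation.Binary.Disjoint.Propositional using (Disjoint)
open import Data.List.Relation.Binary.Permutation.Propositional using (_↭_; ↭-refl)
open import Data.List.Relation.Binary.Pointwise using (Pointwise; []; _∷_; Pointwise-length)
import Data.List.Relation.Binary.Pointwise as Pointwise
open import Data.List.Relation.Unary.All using (All; []; _∷_)
import Data.List.Relation.Unary.All as All
import Data.List.Relation.Unary.All.Properties as Allₚ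
open import Data.List.Relation.Unary.AllPairs using (AllPairs; []; _∷_)
import Data.List.Relation.Unary.AllPairs as AllPairs
import Data.List.Relation.Unary.AllPairs.Properties as AllPairsₚ
open import Data.List.Relation.Unary.Any using (here; there)
import Data.List.Relation.Unary.Any as Any
import Data.List.Relation.Unary.Any.Properties as Anyₚ
open import Data.List.Relation.Unary.Linked using (Linked; []; [-]; _∷_)
open import Data.List.Relation.Unary.Linked.Properties using (AllPairs⇒Linked)
open import Data.List.Relation.Unary.Unique.Propositional using (Unique)
import Data.List.Relation.Unary.Unique.Propositional.Properties as Uniqueₚ
open import Data.Nat
  using (zero; suc; _+_; _*_; _∸_; _<_; _>_; NonZero; >-nonZero; _%_; _/_; _≟_; _<?_; _≤?_; z≤n; s≤s; ∣_-_∣)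
open import Data.List.Membership.DecPropositional _≟_ using (_∈?_)
open import Data.Nat.DivMod
open import Data.Nat.Divisibility
  using (_∣_; divides; ∣⇒≤; n∣m*n; ∣m+n∣m⇒∣n; ∣-trans; ∣-refl; *-monoˡ-∣; *-monoʳ-∣; *-cancelˡ-∣; m%n≡0⇒n∣m)
open import Data.Nat.ListAction using (sum)
open import Data.Nat.ListAction.Properties using (sum-++)
open import Data.Nat.Primality using (euclidsLemma; prime⇒nonZero)
open import Data.Nat.Properties
open import Algebra.Properties.CommutativeSemigroup +-commutativeSemigroup using () renaming (interchange to +-interchange)
open import Data.Nat.Tactic.RingSolver using (solve-∀)
open import Data.Product using (_×_; _,_; proj₁; proj₂; ∃; ∃₂)
open import Data.Sum using (_⊎_; inj₁; inj₂; [_,_]′)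
import Data.Sum as Sum
open import Function using (_∘_)
open import Function.Bundles using (mk⇔)
open import Relation.Binary.Definitions using (tri<; tri≈; tri>)
open import Relation.Binary.PropositionalEquality
open import Relation.Nullary using (¬_; yes; no; ¬?)

partialSumsFrom : ℕ → List ℕ → List ℕ
partialSumsFrom acc [] = []
partialSumsFrom acc (x ∷ xs) = acc + x ∷ partialSumsFrom (acc + x) xs

partialSums≡partialSumsFrom0 : ∀ xs → partialSums xs ≡ partialSumsFrom 0 xs
partialSums≡partialSumsFrom0 [] = refl
partialSums≡partialSumsFrom0 (x ∷ xs) = cons x xs
  where
  cons : ∀ x xs → partialSums (x ∷ xs) ≡ partialSumsFrom 0 (x ∷ xs)
  cons x [] = refl
  cons x (y ∷ ys) = cong (x ∷_) (cons (x + y) ys)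

partialSumsFrom-++ : ∀ acc xs ys →
  partialSumsFrom acc (xs ++ ys) ≡ partialSumsFrom acc xs ++ partialSumsFrom (acc + sum xs) ys
partialSumsFrom-++ acc [] ys = cong (λ a → partialSumsFrom a ys) (sym (+-identityʳ acc))
partialSumsFrom-++ acc (x ∷ xs) ys = cong (acc + x ∷_) (begin
  partialSumsFrom (acc + x) (xs ++ ys)                               ≡⟨ partialSumsFrom-++ (acc + x) xs ys ⟩
  partialSumsFrom (acc + x) xs ++ partialSumsFrom (acc + x + sum xs) ys ≡⟨ cong (λ a → partialSumsFrom (acc + x) xs ++ partialSumsFrom a ys) (+-assoc acc x (sum xs)) ⟩
  partialSumsFrom (acc + x) xs ++ partialSumsFrom (acc + (x + sum xs)) ys ∎)
  where open ≡-Reasoning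

module Modular (q : ℕ) .{{_ : NonZero q}} where

  infix 4 _≈_
  _≈_ : ℕ → ℕ → Set
  a ≈ b = a % q ≡ b % q

  +-cong : ∀ {a b c d} → a ≈ b → c ≈ d → a + c ≈ b + d
  +-cong {a} {b} {c} {d} a≈b c≈d = begin
    (a + c) % q              ≡⟨ %-distribˡ-+ a c q ⟩
    (a % q + c % q) % q      ≡⟨ cong₂ (λ x y → (x + y) % q) a≈b c≈d ⟩
    (b % q + d % q) % q      ≡⟨ %-distribˡ-+ b d q ⟨
    (b + d) % q              ∎
    where open ≡-Reasoning

  %-≈ : ∀ a → a % q ≈ a
  %-≈ a = m%n%n≡m%n a q

  ≈⇒≡ : ∀ {a b} → a < q → b < q → a ≈ b → a ≡ b
  ≈⇒≡ a<q b<q a≈b = trans (sym (m<n⇒m%n≡m a<q)) (trans a≈b (m<n⇒m%n≡m b<q))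

  ∣∸⇒≈ : ∀ {a b} → a ≤ b → q ∣ b ∸ a → a ≈ b
  ∣∸⇒≈ {a} {b} a≤b q∣b∸a = begin
    a % q             ≡⟨ %-remove-+ʳ a q∣b∸a ⟨
    (a + (b ∸ a)) % q ≡⟨ cong (_% q) (m+[n∸m]≡n a≤b) ⟩
    b % q             ∎
    where open ≡-Reasoning

  ≈⇒∣∸ : ∀ {a b} → a ≤ b → a ≈ b → q ∣ b ∸ a
  ≈⇒∣∸ {a} {b} a≤b a≈b = divides (b / q ∸ a / q) (begin
    b ∸ a                                     ≡⟨ cong₂ _∸_ (m≡m%n+[m/n]*n b q) (m≡m%n+[m/n]*n a q) ⟩
    (b % q + b / q * q) ∸ (a % q + a / q * q) ≡⟨ cong (λ r → (r + b / q * q) ∸ (a % q + a / q * q)) a≈b ⟨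
    (a % q + b / q * q) ∸ (a % q + a / q * q) ≡⟨ [m+n]∸[m+o]≡n∸o (a % q) _ _ ⟩
    b / q * q ∸ a / q * q                     ≡⟨ *-distribʳ-∸ q (b / q) (a / q) ⟨
    (b / q ∸ a / q) * q                       ∎)
    where open ≡-Reasoning

  Cong⇒≈ : ∀ {a b} → Cong q a b → a ≈ b
  Cong⇒≈ {a} {b} q∣∣a-b∣ with ≤-total a b
  ... | inj₁ a≤b = ∣∸⇒≈ a≤b (subst (q ∣_) (m≤n⇒∣m-n∣≡n∸m a≤b) q∣∣a-b∣)
  ... | inj₂ b≤a = sym (∣∸⇒≈ b≤a (subst (q ∣_) (m≤n⇒∣n-m∣≡n∸m b≤a) q∣∣a-b∣))

  ≈⇒Cong : ∀ {a b} → a ≈ b → Cong q a b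
  ≈⇒Cong {a} {b} a≈b with ≤-total a b
  ... | inj₁ a≤b = subst (q ∣_) (sym (m≤n⇒∣m-n∣≡n∸m a≤b)) (≈⇒∣∸ a≤b a≈b)
  ... | inj₂ b≤a = subst (q ∣_) (sym (m≤n⇒∣n-m∣≡n∸m b≤a)) (≈⇒∣∸ b≤a (sym a≈b))

  sum-applyUpTo-% : ∀ (f : ℕ → ℕ) n → sum (applyUpTo (λ t → f t % q) n) ≈ sum (applyUpTo f n)
  sum-applyUpTo-% f zero = refl
  sum-applyUpTo-% f (suc n) = +-cong (%-≈ (f 0)) (sum-applyUpTo-% (λ t → f (suc t)) n)

  +-cancelˡ : ∀ c {a b} → c + a ≈ c + b → a ≈ b
  +-cancelˡ c {a} {b} e = Cong⇒≈ (subst (q ∣_) (∣m+n-m+o∣≡∣n-o∣ c a b) (≈⇒Cong e))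

  +-cancelʳ : ∀ c {a b} → a + c ≈ b + c → a ≈ b
  +-cancelʳ c {a} {b} e = +-cancelˡ c (subst₂ _≈_ (+-comm a c) (+-comm b c) e)

  *-cancelˡ : Prime q → ∀ {l a b} → 0 < l → l < q → l * a ≈ l * b → a ≈ b
  *-cancelˡ q-prime {l} {a} {b} 0<l l<q e
    with euclidsLemma l ∣ a - b ∣ q-prime (subst (q ∣_) (sym (*-distribˡ-∣-∣ l a b)) (≈⇒Cong e))
  ... | inj₁ q∣l = ⊥-elim (<⇒≱ l<q (∣⇒≤ {{>-nonZero 0<l}} q∣l))
  ... | inj₂ q∣∣a-b∣ = Cong⇒≈ q∣∣a-b∣

  partialSumsFrom-mod : ∀ {acc acc′} xs ys → acc ≈ acc′ → map (_% q) xs ≡ map (_% q) ys →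
    map (_% q) (partialSumsFrom acc xs) ≡ map (_% q) (partialSumsFrom acc′ ys)
  partialSumsFrom-mod [] [] _ _ = refl
  partialSumsFrom-mod {acc} {acc′} (x ∷ xs) (y ∷ ys) acc≈acc′ eq with ∷-injective eq
  ... | x≈y , xs≈ys = cong₂ _∷_ step (partialSumsFrom-mod xs ys step xs≈ys)
    where
    step : acc + x ≈ acc′ + y
    step = +-cong acc≈acc′ x≈y

  partialSums-mod : ∀ xs ys → map (_% q) xs ≡ map (_% q) ys → map (_% q) (partialSums xs) ≡ map (_% q) (partialSums ys)
  partialSums-mod xs ys eq = begin
    map (_% q) (partialSums xs)       ≡⟨ cong (map (_% q)) (partialSums≡partialSumsFrom0 xs) ⟩
    map (_% q) (partialSumsFrom 0 xs) ≡⟨ partialSumsFrom-mod xs ys refl eq ⟩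
    map (_% q) (partialSumsFrom 0 ys) ≡⟨ cong (map (_% q)) (partialSums≡partialSumsFrom0 ys) ⟨
    map (_% q) (partialSums ys)       ∎
    where open ≡-Reasoning

-- Positions past the end give the junk value 0; only positions below the length are ever used.
nth : List ℕ → ℕ → ℕ
nth [] _ = 0
nth (x ∷ xs) zero = x
nth (x ∷ xs) (suc t) = nth xs t

nth-∈ : ∀ xs {t} → t < length xs → nth xs t ∈ xs
nth-∈ (x ∷ xs) {zero} _ = here refl
nth-∈ (x ∷ xs) {suc t} (s≤s t<n) = there (nth-∈ xs t<n)

∈⇒nth : ∀ {v} xs → v ∈ xs → ∃ λ t → t < length xs × nth xs t ≡ v
∈⇒nth (x ∷ xs) (here refl) = 0 , s≤s z≤n , refl
∈⇒nth (x ∷ xs) (there v∈xs) with ∈⇒nth xs v∈xs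
... | t , t<n , eq = suc t , s≤s t<n , eq

nth-injective : ∀ {xs} → Unique xs → ∀ {t u} → t < length xs → u < length xs → nth xs t ≡ nth xs u → t ≡ u
nth-injective {x ∷ xs} _ {zero} {zero} _ _ _ = refl
nth-injective {x ∷ xs} (x∉xs ∷ _) {zero} {suc u} _ (s≤s u<n) eq = ⊥-elim (All.lookup x∉xs (nth-∈ xs u<n) eq)
nth-injective {x ∷ xs} (x∉xs ∷ _) {suc t} {zero} (s≤s t<n) _ eq = ⊥-elim (All.lookup x∉xs (nth-∈ xs t<n) (sym eq))
nth-injective {x ∷ xs} (_ ∷ uxs) {suc t} {suc u} (s≤s t<n) (s≤s u<n) eq = cong suc (nth-injective uxs t<n u<n eq)

applyUpTo-nth : ∀ xs → applyUpTo (nth xs) (length xs) ≡ xs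
applyUpTo-nth [] = refl
applyUpTo-nth (x ∷ xs) = cong (x ∷_) (applyUpTo-nth xs)

grid : (ℕ → ℕ → ℕ) → ℕ → ℕ → List ℕ
grid f n₁ n₂ = concat (applyUpTo (λ u → applyUpTo (f u) n₂) n₁)

module _ (f : ℕ → ℕ → ℕ) (n₁ n₂ : ℕ) where

  ∈-grid⁺ : ∀ {u w} → u < n₁ → w < n₂ → f u w ∈ grid f n₁ n₂
  ∈-grid⁺ u<n₁ w<n₂ = ∈-concat⁺′ (∈-applyUpTo⁺ (f _) w<n₂) (∈-applyUpTo⁺ (λ u → applyUpTo (f u) n₂) u<n₁)

  ∈-grid⁻ : ∀ {v} → v ∈ grid f n₁ n₂ → ∃₂ λ u w → u < n₁ × w < n₂ × v ≡ f u w
  ∈-grid⁻ v∈ with ∈-concat⁻′ (applyUpTo (λ u → applyUpTo (f u) n₂) n₁) v∈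
  ... | row , v∈row , row∈ with ∈-applyUpTo⁻ (λ u → applyUpTo (f u) n₂) row∈
  ... | u , u<n₁ , refl with ∈-applyUpTo⁻ (f u) v∈row
  ... | w , w<n₂ , v≡ = u , w , u<n₁ , w<n₂ , v≡

  grid-unique : (∀ {u u′ w w′} → u < n₁ → u′ < n₁ → w < n₂ → w′ < n₂ → f u w ≡ f u′ w′ → u ≡ u′ × w ≡ w′) →
    Unique (grid f n₁ n₂)
  grid-unique inj = Uniqueₚ.concat⁺ (Allₚ.applyUpTo⁺₁ _ n₁ row-unique) (AllPairsₚ.applyUpTo⁺₁ _ n₁ rows-disjoint)
    where
    row-unique : ∀ {u} → u < n₁ → Unique (applyUpTo (f u) n₂)
    row-unique u<n₁ = Uniqueₚ.applyUpTo⁺₁ _ n₂ λ w<w′ w′<n₂ eq →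
      <⇒≢ w<w′ (proj₂ (inj u<n₁ u<n₁ (<-trans w<w′ w′<n₂) w′<n₂ eq))
    rows-disjoint : ∀ {u u′} → u < u′ → u′ < n₁ → Disjoint (applyUpTo (f u) n₂) (applyUpTo (f u′) n₂)
    rows-disjoint u<u′ u′<n₁ (v∈row , v∈row′) with ∈-applyUpTo⁻ _ v∈row | ∈-applyUpTo⁻ _ v∈row′
    ... | w , w<n₂ , refl | w′ , w′<n₂ , eq = <⇒≢ u<u′ (proj₁ (inj (<-trans u<u′ u′<n₁) u′<n₁ w<n₂ w′<n₂ eq))

length-grid : ∀ f n₁ n₂ → length (grid f n₁ n₂) ≡ n₁ * n₂
length-grid f zero n₂ = refl
length-grid f (suc n₁) n₂ = begin
  length (applyUpTo (f 0) n₂ ++ grid (λ u → f (suc u)) n₁ n₂)         ≡⟨ length-++ (applyUpTo (f 0) n₂) ⟩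
  length (applyUpTo (f 0) n₂) + length (grid (λ u → f (suc u)) n₁ n₂) ≡⟨ cong₂ _+_ (length-applyUpTo (f 0) n₂) (length-grid (λ u → f (suc u)) n₁ n₂) ⟩
  n₂ + n₁ * n₂                                                         ∎
  where open ≡-Reasoning

private
  without : ℕ → List ℕ → List ℕ
  without x = filter (λ z → ¬? (z ≟ x))

  length-without< : ∀ {x zs} → x ∈ zs → length (without x zs) < length zs
  length-without< {x} {zs} x∈zs = filter-notAll (λ z → ¬? (z ≟ x)) zs (Any.map (λ x≡z z≢x → z≢x (sym x≡z)) x∈zs)

  ⊆⇒length≤ : ∀ {xs zs : List ℕ} → Unique xs → (∀ {v} → v ∈ xs → v ∈ zs) → length xs ≤ length zs
  ⊆⇒length≤ {[]} _ _ = z≤n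
  ⊆⇒length≤ {x ∷ xs} {zs} (x∉xs ∷ uxs) xs⊆zs =
    ≤-trans (s≤s (⊆⇒length≤ uxs xs⊆zs-x)) (length-without< (xs⊆zs (here refl)))
    where
    xs⊆zs-x : ∀ {v} → v ∈ xs → v ∈ without x zs
    xs⊆zs-x v∈xs = ∈-filter⁺ (λ z → ¬? (z ≟ x)) (xs⊆zs (there v∈xs)) (λ v≡x → All.lookup x∉xs v∈xs (sym v≡x))

  ⊆∧length⇒⊇ : ∀ {xs ys : List ℕ} → Unique xs → (∀ {v} → v ∈ xs → v ∈ ys) → length ys ≤ length xs →
    ∀ {y} → y ∈ ys → y ∈ xs
  ⊆∧length⇒⊇ {xs} {ys} uxs xs⊆ys |ys|≤|xs| {y} y∈ys with y ∈? xs
  ... | yes y∈xs = y∈xs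
  ... | no y∉xs = ⊥-elim (<-irrefl refl (<-≤-trans (≤-<-trans (⊆⇒length≤ uxs xs⊆ys-y) (length-without< y∈ys)) |ys|≤|xs|))
    where
    xs⊆ys-y : ∀ {v} → v ∈ xs → v ∈ without y ys
    xs⊆ys-y v∈xs = ∈-filter⁺ (λ z → ¬? (z ≟ y)) (xs⊆ys v∈xs) (λ v≡y → y∉xs (subst (_∈ xs) v≡y v∈xs))

unique-⊆-length⇒↭ : ∀ {xs ys : List ℕ} → Unique xs → Unique ys → (∀ {v} → v ∈ xs → v ∈ ys) →
  length ys ≤ length xs → xs ↭ ys
unique-⊆-length⇒↭ uxs uys xs⊆ys |ys|≤|xs| =
  ∼bag⇒↭ (unique∧set⇒bag uxs uys (mk⇔ xs⊆ys (⊆∧length⇒⊇ uxs xs⊆ys |ys|≤|xs|)))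

Pointwise⇒All : ∀ {R : ℕ → ℕ → Set} {P Q : ℕ → Set} → (∀ {g r} → R g r → P g → Q r) →
  ∀ {gs rs} → Pointwise R gs rs → All P gs → All Q rs
Pointwise⇒All f [] [] = []
Pointwise⇒All f (g∼r ∷ gs∼rs) (pg ∷ pgs) = f g∼r pg ∷ Pointwise⇒All f gs∼rs pgs

All⇒AllPairs : ∀ {P : ℕ → Set} {R : ℕ → ℕ → Set} → (∀ {x y} → P x → P y → R x y) → ∀ {xs} → All P xs → AllPairs R xs
All⇒AllPairs f [] = []
All⇒AllPairs f (px ∷ pxs) = All.map (f px) pxs ∷ All⇒AllPairs f pxs

applyUpTo-cong : ∀ {f g : ℕ → ℕ} → (∀ t → f t ≡ g t) → ∀ n → applyUpTo f n ≡ applyUpTo g n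
applyUpTo-cong f≗g zero = refl
applyUpTo-cong f≗g (suc n) = cong₂ _∷_ (f≗g 0) (applyUpTo-cong (λ t → f≗g (suc t)) n)

sum-applyUpTo-suc : ∀ (f : ℕ → ℕ) n → sum (applyUpTo f (suc n)) ≡ sum (applyUpTo f n) + f n
sum-applyUpTo-suc f n = begin
  sum (applyUpTo f (suc n))          ≡⟨ cong sum (applyUpTo-∷ʳ f n) ⟨
  sum (applyUpTo f n ∷ʳ f n)         ≡⟨ sum-++ (applyUpTo f n) (f n ∷ []) ⟩
  sum (applyUpTo f n) + (f n + 0)    ≡⟨ cong (sum (applyUpTo f n) +_) (+-identityʳ (f n)) ⟩
  sum (applyUpTo f n) + f n          ∎
  where open ≡-Reasoning

sum-applyUpTo-cong : ∀ {f g : ℕ → ℕ} n → (∀ {t} → t < n → f t ≡ g t) → sum (applyUpTo f n) ≡ sum (applyUpTo g n)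
sum-applyUpTo-cong zero _ = refl
sum-applyUpTo-cong (suc n) f≗g = cong₂ _+_ (f≗g (s≤s z≤n)) (sum-applyUpTo-cong n (λ t<n → f≗g (s≤s t<n)))

sum-applyUpTo-+ : ∀ (f g : ℕ → ℕ) n → sum (applyUpTo (λ t → f t + g t) n) ≡ sum (applyUpTo f n) + sum (applyUpTo g n)
sum-applyUpTo-+ f g zero = refl
sum-applyUpTo-+ f g (suc n) = begin
  f 0 + g 0 + sum (applyUpTo (λ t → f (suc t) + g (suc t)) n) ≡⟨ cong (f 0 + g 0 +_) (sum-applyUpTo-+ (λ t → f (suc t)) (λ t → g (suc t)) n) ⟩
  f 0 + g 0 + (sum (applyUpTo (λ t → f (suc t)) n) + sum (applyUpTo (λ t → g (suc t)) n)) ≡⟨ +-interchange (f 0) (g 0) _ _ ⟩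
  f 0 + sum (applyUpTo (λ t → f (suc t)) n) + (g 0 + sum (applyUpTo (λ t → g (suc t)) n)) ∎
  where open ≡-Reasoning

sum-applyUpTo-*ʳ : ∀ (f : ℕ → ℕ) m n → sum (applyUpTo (λ t → f t * m) n) ≡ sum (applyUpTo f n) * m
sum-applyUpTo-*ʳ f m zero = refl
sum-applyUpTo-*ʳ f m (suc n) = begin
  f 0 * m + sum (applyUpTo (λ t → f (suc t) * m) n)  ≡⟨ cong (f 0 * m +_) (sum-applyUpTo-*ʳ (λ t → f (suc t)) m n) ⟩
  f 0 * m + sum (applyUpTo (λ t → f (suc t)) n) * m  ≡⟨ *-distribʳ-+ m (f 0) _ ⟨
  (f 0 + sum (applyUpTo (λ t → f (suc t)) n)) * m    ∎
  where open ≡-Reasoning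

+*-injective : ∀ {m r r′ a a′} .{{_ : NonZero m}} → r < m → r′ < m → r + a * m ≡ r′ + a′ * m → r ≡ r′ × a ≡ a′
+*-injective {m} {r} {r′} {a} {a′} r<m r′<m eq =
  r≡r′ , *-cancelʳ-≡ a a′ m (+-cancelˡ-≡ r _ _ (trans eq (cong (_+ a′ * m) (sym r≡r′))))
  where
  r≡r′ : r ≡ r′
  r≡r′ = begin
    r                 ≡⟨ m<n⇒m%n≡m r<m ⟨
    r % m             ≡⟨ [m+kn]%n≡m%n r a m ⟨
    (r + a * m) % m   ≡⟨ cong (_% m) eq ⟩
    (r′ + a′ * m) % m ≡⟨ [m+kn]%n≡m%n r′ a′ m ⟩
    r′ % m            ≡⟨ m<n⇒m%n≡m r′<m ⟩
    r′                ∎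
    where open ≡-Reasoning

sum-twice-arithmetic : ∀ j i n → sum (applyUpTo (λ t → 2 * (j + suc t * i)) n) ≡ 2 * n * j + n * suc n * i
sum-twice-arithmetic j i zero = refl
sum-twice-arithmetic j i (suc n) = begin
  sum (applyUpTo f (suc n))                       ≡⟨ sum-applyUpTo-suc f n ⟩
  sum (applyUpTo f n) + f n                       ≡⟨ cong (_+ f n) (sum-twice-arithmetic j i n) ⟩
  2 * n * j + n * suc n * i + 2 * (j + suc n * i) ≡⟨ rearrange j i n ⟩
  2 * suc n * j + suc n * suc (suc n) * i         ∎
  where
  open ≡-Reasoning
  f : ℕ → ℕ
  f t = 2 * (j + suc t * i)
  rearrange : ∀ j i n → 2 * n * j + n * suc n * i + 2 * (j + suc n * i) ≡ 2 * suc n * j + suc n * suc (suc n) * i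
  rearrange = solve-∀

oddOrder : ℕ → ℕ
oddOrder k = suc (k + k)

-- For residues r, v < m this says r ≡ ±v (mod m).
infix 4 _≡±_mod_
_≡±_mod_ : ℕ → ℕ → ℕ → Set
r ≡± v mod m = r ≡ v ⊎ r + v ≡ m

module _ {m : ℕ} where

  ≡±-trans : ∀ {r g v} → r ≡± g mod m → g ≡± v mod m → r ≡± v mod m
  ≡±-trans (inj₁ refl) g≡±v = g≡±v
  ≡±-trans (inj₂ r+g≡m) (inj₁ refl) = inj₂ r+g≡m
  ≡±-trans {r} {g} {v} (inj₂ r+g≡m) (inj₂ g+v≡m) = inj₁ (+-cancelʳ-≡ g r v (trans r+g≡m (sym (trans (+-comm v g) g+v≡m))))

  ≡±-range : ∀ {r v} → 0 < v → v < m → r ≡± v mod m → 0 < r × r < m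
  ≡±-range 0<v v<m (inj₁ refl) = 0<v , v<m
  ≡±-range {r} {v} 0<v v<m (inj₂ r+v≡m) = 0<r , r<m
    where
    r≡m∸v : r ≡ m ∸ v
    r≡m∸v = sym (trans (cong (_∸ v) (sym r+v≡m)) (m+n∸n≡m r v))
    0<r : 0 < r
    0<r = subst (0 <_) (sym r≡m∸v) (m<n⇒0<n∸m v<m)
    r<m : r < m
    r<m = subst (_< m) (sym r≡m∸v) (∸-monoʳ-< 0<v (<⇒≤ v<m))

  ≡±-distinct : ∀ {r r′ g g′} → g ≢ g′ → g + g′ ≢ m → r ≡± g mod m → r′ ≡± g′ mod m → r ≢ r′
  ≡±-distinct g≢g′ _ (inj₁ refl) (inj₁ refl) = g≢g′
  ≡±-distinct _ g+g′≢m (inj₁ refl) (inj₂ r′+g′≡m) refl = g+g′≢m r′+g′≡m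
  ≡±-distinct {g = g} {g′} _ g+g′≢m (inj₂ r+g≡m) (inj₁ refl) refl = g+g′≢m (trans (+-comm g g′) r+g≡m)
  ≡±-distinct {r} {g = g} {g′} g≢g′ _ (inj₂ r+g≡m) (inj₂ r+g′≡m) refl = g≢g′ (+-cancelˡ-≡ r g g′ (trans r+g≡m (sym r+g′≡m)))

-- A simple (k,k)_1 Heffter system over Z_(2k+1) consisting of a single block.
record SimpleZeroSumHalfSet (k : ℕ) : Set where
  field
    elements : List ℕ
    length-elements : length elements ≡ k
    elements-range : All (λ r → 0 < r × r < oddOrder k) elements
    elements-unique : Unique elements
    elements-cover : ∀ {v} → 0 < v → v < oddOrder k → ∃ λ r → r ∈ elements × r ≡± v mod oddOrder k
    zero-sum : oddOrder k ∣ sum elements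
    distinct-partial-sums : AllPairs (λ a b → a % oddOrder k ≢ b % oddOrder k) (partialSums elements)

module Lifting {p k : ℕ} (p-prime : Prime p) (3≤k : 3 ≤ k) (k≤p : k ≤ p) (H : SimpleZeroSumHalfSet k) where

  open SimpleZeroSumHalfSet H

  instance
    p-nonZero : NonZero p
    p-nonZero = prime⇒nonZero p-prime

  module P = Modular p

  m N : ℕ
  m = oddOrder k
  N = order p k p

  N≡p*m : N ≡ p * m
  N≡p*m = 2pk+p≡p[1+k+k] p k
    where
    2pk+p≡p[1+k+k] : ∀ p k → 2 * p * k + p ≡ p * suc (k + k)
    2pk+p≡p[1+k+k] = solve-∀

  m∣N : m ∣ N
  m∣N = divides p N≡p*m

  ρ : ℕ → ℕ
  ρ = nth elements

  private
    <k⇒<length : ∀ {t} → t < k → t < length elements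
    <k⇒<length = subst (_ <_) (sym length-elements)

  ρ-range : ∀ {t} → t < k → 0 < ρ t × ρ t < m
  ρ-range t<k = All.lookup elements-range (nth-∈ elements (<k⇒<length t<k))

  ρ-injective : ∀ {t u} → t < k → u < k → ρ t ≡ ρ u → t ≡ u
  ρ-injective t<k u<k = nth-injective elements-unique (<k⇒<length t<k) (<k⇒<length u<k)

  ρ-cover : ∀ {v} → 0 < v → v < m → ∃ λ t → t < k × ρ t ≡± v mod m
  ρ-cover 0<v v<m with elements-cover 0<v v<m
  ... | r , r∈ , r≡±v with ∈⇒nth elements r∈
  ... | t , t<n , refl = t , subst (t <_) length-elements t<n , r≡±v

  applyUpTo-ρ : applyUpTo ρ k ≡ elements
  applyUpTo-ρ = subst (λ n → applyUpTo ρ n ≡ elements) length-elements (applyUpTo-nth elements)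

  K L : ℕ
  K = k ∸ 2
  L = p ∸ K

  k≡2+K : k ≡ 2 + K
  k≡2+K = sym (m+[n∸m]≡n (≤-trans (n≤1+n 2) 3≤k))

  K<k : K < k
  K<k = subst (K <_) (sym k≡2+K) (<-trans (n<1+n K) (n<1+n (suc K)))

  K<p : K < p
  K<p = <-≤-trans K<k k≤p

  L+K≡p : L + K ≡ p
  L+K≡p = m∸n+n≡m (<⇒≤ K<p)

  L-unit : 0 < L × L < p
  L-unit = m<n⇒0<n∸m K<p , ∸-monoʳ-< 0<K (<⇒≤ K<p)
    where
    0<K : 0 < K
    0<K = ≤-pred (≤-pred (subst (3 ≤_) k≡2+K 3≤k))

  -- λ = (L, 2, …, 2, L): Σ λ_t = 2p and Σ t λ_t = (K + 1) p.
  multiplier : ℕ → ℕ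
  multiplier zero = L
  multiplier (suc t) with t <? K
  ... | yes _ = 2
  ... | no _ = L

  multiplier-inner : ∀ {t} → t < K → multiplier (suc t) ≡ 2
  multiplier-inner {t} t<K with t <? K
  ... | yes _ = refl
  ... | no t≮K = ⊥-elim (t≮K t<K)

  multiplier-last : multiplier (suc K) ≡ L
  multiplier-last with K <? K
  ... | yes K<K = ⊥-elim (<-irrefl refl K<K)
  ... | no _ = refl

  multiplier-unit : ∀ t → 0 < multiplier t × multiplier t < p
  multiplier-unit zero = L-unit
  multiplier-unit (suc t) with t <? K
  ... | yes _ = s≤s z≤n , ≤-trans 3≤k k≤p
  ... | no _ = L-unit

  sum-multiplied : ∀ i j → sum (applyUpTo (λ t → multiplier t * (j + t * i)) k) ≡ p * (2 * j + suc K * i)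
  sum-multiplied i j = begin
    sum (applyUpTo f k)                                               ≡⟨ cong (sum ∘ applyUpTo f) k≡2+K ⟩
    f 0 + sum (applyUpTo (f ∘ suc) (suc K))                           ≡⟨ cong (f 0 +_) (sum-applyUpTo-suc (f ∘ suc) K) ⟩
    f 0 + (sum (applyUpTo (f ∘ suc) K) + f (suc K))                   ≡⟨ cong₂ (λ inner last → f 0 + (inner + last * (j + suc K * i)))
                                                                               (trans (sum-applyUpTo-cong K inner≡2) (sum-twice-arithmetic j i K)) multiplier-last ⟩
    L * (j + 0) + (2 * K * j + K * suc K * i + L * (j + suc K * i))   ≡⟨ collect L K j i ⟩
    (L + K) * (2 * j + suc K * i)                                     ≡⟨ cong (_* (2 * j + suc K * i)) L+K≡p ⟩
    p * (2 * j + suc K * i)                                           ∎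
    where
    open ≡-Reasoning
    f : ℕ → ℕ
    f t = multiplier t * (j + t * i)
    inner≡2 : ∀ {t} → t < K → f (suc t) ≡ 2 * (j + suc t * i)
    inner≡2 {t} t<K = cong (_* (j + suc t * i)) (multiplier-inner t<K)
    collect : ∀ L K j i → L * (j + 0) + (2 * K * j + K * suc K * i + L * (j + suc K * i)) ≡ (L + K) * (2 * j + suc K * i)
    collect = solve-∀

  T : ℕ
  T = sum elements / m

  -- Compensates the contribution T m of the base block to every block sum.
  offset : ℕ → ℕ
  offset zero = (p ∸ 1) * T
  offset (suc _) = 0

  sum-offset : sum (applyUpTo offset k) ≡ (p ∸ 1) * T
  sum-offset = begin
    sum (applyUpTo offset k)                        ≡⟨ cong (sum ∘ applyUpTo offset) k≡2+K ⟩
    (p ∸ 1) * T + sum (applyUpTo (λ _ → 0) (suc K)) ≡⟨ cong ((p ∸ 1) * T +_) (zeros (suc K)) ⟩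
    (p ∸ 1) * T + 0                                 ≡⟨ +-identityʳ _ ⟩
    (p ∸ 1) * T                                     ∎
    where
    open ≡-Reasoning
    zeros : ∀ n → sum (applyUpTo (λ _ → 0) n) ≡ 0
    zeros zero = refl
    zeros (suc n) = zeros n

  T+sum-uncorrected : ∀ i j → T + sum (applyUpTo (λ t → multiplier t * (j + t * i) + offset t) k) ≡ (2 * j + suc K * i + T) * p
  T+sum-uncorrected i j = begin
    T + sum (applyUpTo (λ t → multiplier t * (j + t * i) + offset t) k)  ≡⟨ cong (T +_) (sum-applyUpTo-+ _ offset k) ⟩
    T + (sum (applyUpTo (λ t → multiplier t * (j + t * i)) k) + sum (applyUpTo offset k))
                                                                         ≡⟨ cong₂ (λ s o → T + (s + o)) (sum-multiplied i j) sum-offset ⟩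
    T + (p * X + (p ∸ 1) * T)                                            ≡⟨ cong (λ p′ → T + (p′ * X + (p ∸ 1) * T)) p≡1+[p∸1] ⟩
    T + (suc (p ∸ 1) * X + (p ∸ 1) * T)                                  ≡⟨ collect (p ∸ 1) X T ⟩
    (X + T) * suc (p ∸ 1)                                                ≡⟨ cong ((X + T) *_) p≡1+[p∸1] ⟨
    (X + T) * p                                                          ∎
    where
    open ≡-Reasoning
    X : ℕ
    X = 2 * j + suc K * i
    p≡1+[p∸1] : p ≡ suc (p ∸ 1)
    p≡1+[p∸1] = sym (m+[n∸m]≡n {1} (≤-trans (s≤s z≤n) (≤-trans 3≤k k≤p)))
    collect : ∀ q X T → T + (suc q * X + q * T) ≡ (X + T) * suc q
    collect = solve-∀

  opaque
    coefficient : ℕ → ℕ → ℕ → ℕ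
    coefficient t i j = (multiplier t * (j + t * i) + offset t) % p

  opaque
    unfolding coefficient

    coefficient<p : ∀ t i j → coefficient t i j < p
    coefficient<p t i j = m%n<n _ p

    coefficient-≈ : ∀ {t i i′ j j′} → coefficient t i j ≡ coefficient t i′ j′ → j + t * i P.≈ j′ + t * i′
    coefficient-≈ {t} eq = P.*-cancelˡ p-prime (proj₁ (multiplier-unit t)) (proj₂ (multiplier-unit t)) (P.+-cancelʳ (offset t) eq)

    p∣T+sum-coefficients : ∀ i j → p ∣ T + sum (applyUpTo (λ t → coefficient t i j) k)
    p∣T+sum-coefficients i j = m%n≡0⇒n∣m _ p (begin
      (T + sum (applyUpTo (λ t → coefficient t i j) k)) % p                       ≡⟨ P.+-cong {T} refl (P.sum-applyUpTo-% _ k) ⟩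
      (T + sum (applyUpTo (λ t → multiplier t * (j + t * i) + offset t) k)) % p   ≡⟨ cong (_% p) (T+sum-uncorrected i j) ⟩
      (2 * j + suc K * i + T) * p % p                                             ≡⟨ m*n%n≡0 (2 * j + suc K * i + T) p ⟩
      0                                                                           ∎)
      where open ≡-Reasoning

  element : ℕ → ℕ → ℕ → ℕ
  element i j t = ρ t + coefficient t i j * m

  block : ℕ → ℕ → List ℕ
  block i j = applyUpTo (element i j) k

  N∣sum-block : ∀ i j → N ∣ sum (block i j)
  N∣sum-block i j = subst₂ _∣_ (sym N≡p*m) (sym sum-block) (*-monoˡ-∣ m (p∣T+sum-coefficients i j))
    where
    open ≡-Reasoning
    sum-block : sum (block i j) ≡ (T + sum (applyUpTo (λ t → coefficient t i j) k)) * m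
    sum-block = begin
      sum (block i j)                                                              ≡⟨ sum-applyUpTo-+ ρ _ k ⟩
      sum (applyUpTo ρ k) + sum (applyUpTo (λ t → coefficient t i j * m) k)        ≡⟨ cong₂ _+_ (cong sum applyUpTo-ρ) (sum-applyUpTo-*ʳ _ m k) ⟩
      sum elements + sum (applyUpTo (λ t → coefficient t i j) k) * m               ≡⟨ cong (_+ sum (applyUpTo (λ t → coefficient t i j) k) * m) (m/n*n≡m zero-sum) ⟨
      T * m + sum (applyUpTo (λ t → coefficient t i j) k) * m                      ≡⟨ *-distribʳ-+ m T _ ⟨
      (T + sum (applyUpTo (λ t → coefficient t i j) k)) * m                        ∎

  V : List ℕ
  V = grid (λ t a → ρ t + a * m) k p

  ∈V⁻ : ∀ {x} → x ∈ V → ∃₂ λ t a → t < k × a < p × x ≡ ρ t + a * m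
  ∈V⁻ = ∈-grid⁻ _ k p

  ∈V⁺ : ∀ {t a} → t < k → a < p → ρ t + a * m ∈ V
  ∈V⁺ = ∈-grid⁺ _ k p

  V-unique : Unique V
  V-unique = grid-unique _ k p λ t<k t′<k _ _ eq →
    let ρt≡ρt′ , a≡a′ = +*-injective (proj₂ (ρ-range t<k)) (proj₂ (ρ-range t′<k)) eq
    in ρ-injective t<k t′<k ρt≡ρt′ , a≡a′

  V-bounded : ∀ {x} → x ∈ V → x < N
  V-bounded x∈V with ∈V⁻ x∈V
  ... | t , a , t<k , a<p , refl = subst (ρ t + a * m <_) (sym N≡p*m) (begin-strict
    ρ t + a * m  <⟨ +-monoˡ-< (a * m) (proj₂ (ρ-range t<k)) ⟩
    suc a * m    ≤⟨ *-monoˡ-≤ m a<p ⟩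
    p * m        ∎)
    where open ≤-Reasoning

  ∈V⇒¬m∣ : ∀ {x} → x ∈ V → ¬ m ∣ x
  ∈V⇒¬m∣ x∈V m∣x with ∈V⁻ x∈V
  ... | t , a , t<k , a<p , refl =
    <⇒≱ (proj₂ (ρ-range t<k)) (∣⇒≤ {{>-nonZero (proj₁ (ρ-range t<k))}} (∣m+n∣m⇒∣n (subst (m ∣_) (+-comm (ρ t) (a * m)) m∣x) (n∣m*n a)))

  InJ⇒m∣ : ∀ {x} → InJ N p x → m ∣ x
  InJ⇒m∣ {x} N∣p*x = *-cancelˡ-∣ p (subst (_∣ p * x) N≡p*m N∣p*x)

  /m<p : ∀ {x} → x < N → x / m < p
  /m<p {x} x<N = m<n*o⇒m/o<n (subst (x <_) N≡p*m x<N)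

  ¬InJ⇒∈V∪-V : ∀ {x} → x < N → ¬ InJ N p x → x ∈ V ⊎ NegIn N V x
  ¬InJ⇒∈V∪-V {x} x<N x∉J with ρ-cover 0<r (m%n<n x m)
    where
    0<r : 0 < x % m
    0<r = n≢0⇒n>0 λ r≡0 → x∉J (subst (_∣ p * x) (sym N≡p*m) (*-monoʳ-∣ p (m%n≡0⇒n∣m x m r≡0)))
  ... | t , t<k , inj₁ ρt≡r = inj₁ (subst (_∈ V) x≡ (∈V⁺ t<k (/m<p x<N)))
    where
    x≡ : ρ t + x / m * m ≡ x
    x≡ = trans (cong (_+ x / m * m) ρt≡r) (sym (m≡m%n+[m/n]*n x m))
  ... | t , t<k , inj₂ ρt+r≡m = inj₂ (ρ t + a′ * m , ∈V⁺ t<k a′<p , subst (N ∣_) (sym x+y≡N) ∣-refl)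
    where
    a a′ : ℕ
    a = x / m
    a′ = p ∸ suc a
    a<p : a < p
    a<p = /m<p x<N
    a′<p : a′ < p
    a′<p = ∸-monoʳ-< (s≤s z≤n) a<p
    x+y≡N : x + (ρ t + a′ * m) ≡ N
    x+y≡N = begin
      x + (ρ t + a′ * m)                 ≡⟨ cong (_+ (ρ t + a′ * m)) (m≡m%n+[m/n]*n x m) ⟩
      (x % m + a * m) + (ρ t + a′ * m)   ≡⟨ regroup (x % m) a (ρ t) a′ m ⟩
      (ρ t + x % m) + (a + a′) * m       ≡⟨ cong (_+ (a + a′) * m) ρt+r≡m ⟩
      suc (a + a′) * m                   ≡⟨ cong (_* m) (m+[n∸m]≡n a<p) ⟩
      p * m                              ≡⟨ N≡p*m ⟨
      N                                  ∎
      where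
      open ≡-Reasoning
      regroup : ∀ r a ρ a′ m → (r + a * m) + (ρ + a′ * m) ≡ (ρ + r) + (a + a′) * m
      regroup = solve-∀

  halfSet : HalfSet N p (p * k) V
  halfSet = All.tabulate V-bounded , V-unique , trans (length-grid _ k p) (*-comm k p) ,
            λ x x<N → mk⇔ (∈V∪-V⇒¬InJ x) (¬InJ⇒∈V∪-V x<N)
    where
    ∈V∪-V⇒¬InJ : ∀ x → x ∈ V ⊎ NegIn N V x → ¬ InJ N p x
    ∈V∪-V⇒¬InJ x (inj₁ x∈V) x∈J = ∈V⇒¬m∣ x∈V (InJ⇒m∣ x∈J)
    ∈V∪-V⇒¬InJ x (inj₂ (y , y∈V , N∣x+y)) x∈J = ∈V⇒¬m∣ y∈V (∣m+n∣m⇒∣n (∣-trans m∣N N∣x+y) (InJ⇒m∣ x∈J))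

  coefficient-injective : ∀ {t i j j′} → j < p → j′ < p → coefficient t i j ≡ coefficient t i j′ → j ≡ j′
  coefficient-injective {t} {i} {j} {j′} j<p j′<p eq = P.≈⇒≡ j<p j′<p (P.+-cancelʳ (t * i) (coefficient-≈ eq))

  coefficients-determine-system : ∀ {t u i i′ j j′} → u < t → t < k → i < p → i′ < p →
    coefficient t i j ≡ coefficient t i′ j′ → coefficient u i j ≡ coefficient u i′ j′ → i ≡ i′
  coefficients-determine-system {t} {u} {i} {i′} {j} {j′} u<t t<k i<p i′<p eq-t eq-u =
    P.≈⇒≡ i<p i′<p (P.*-cancelˡ p-prime (m<n⇒0<n∸m u<t) (≤-<-trans (m∸n≤m t u) (<-≤-trans t<k k≤p)) d*i≈d*i′)
    where
    d : ℕ
    d = t ∸ u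
    distrib : ∀ j u d i → j + (u + d) * i ≡ (j + u * i) + d * i
    distrib = solve-∀
    split : ∀ j i → j + t * i ≡ (j + u * i) + d * i
    split j i = trans (cong (λ t′ → j + t′ * i) (sym (m+[n∸m]≡n (<⇒≤ u<t)))) (distrib j u d i)
    d*i≈d*i′ : d * i P.≈ d * i′
    d*i≈d*i′ = P.+-cancelˡ (j′ + u * i′) (begin
      (j′ + u * i′ + d * i) % p  ≡⟨ P.+-cong (coefficient-≈ eq-u) refl ⟨
      (j + u * i + d * i) % p    ≡⟨ cong (_% p) (split j i) ⟨
      (j + t * i) % p            ≡⟨ coefficient-≈ eq-t ⟩
      (j′ + t * i′) % p          ≡⟨ cong (_% p) (split j′ i′) ⟩
      (j′ + u * i′ + d * i′) % p ∎)
      where open ≡-Reasoning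

  element-injective : ∀ {i i′ j j′ t t′} → t < k → t′ < k → element i j t ≡ element i′ j′ t′ →
    t ≡ t′ × coefficient t i j ≡ coefficient t′ i′ j′
  element-injective t<k t′<k eq =
    let ρt≡ρt′ , c≡c′ = +*-injective (proj₂ (ρ-range t<k)) (proj₂ (ρ-range t′<k)) eq
    in ρ-injective t<k t′<k ρt≡ρt′ , c≡c′

  block-meet : ∀ {i i′ j j′ x} → x ∈ block i j → x ∈ block i′ j′ →
    ∃ λ t → t < k × x ≡ element i j t × coefficient t i j ≡ coefficient t i′ j′
  block-meet x∈B x∈B′ with ∈-applyUpTo⁻ _ x∈B | ∈-applyUpTo⁻ _ x∈B′
  ... | t , t<k , refl | t′ , t′<k , eq with element-injective t<k t′<k eq
  ... | refl , c≡c′ = t , t<k , refl , c≡c′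

  system : ℕ → List (List ℕ)
  system i = applyUpTo (block i) p

  system↭V : ∀ i → concat (system i) ↭ V
  system↭V i = unique-⊆-length⇒↭ system-unique V-unique system⊆V
    (≤-reflexive (trans (length-grid _ k p) (trans (*-comm k p) (sym (length-grid (element i) p k)))))
    where
    system-unique : Unique (grid (element i) p k)
    system-unique = grid-unique (element i) p k λ j<p j′<p t<k t′<k eq →
      let t≡t′ , c≡c′ = element-injective t<k t′<k eq
      in coefficient-injective j<p j′<p (trans c≡c′ (cong (λ t → coefficient t i _) (sym t≡t′))) , t≡t′
    system⊆V : ∀ {x} → x ∈ grid (element i) p k → x ∈ V
    system⊆V x∈ with ∈-grid⁻ (element i) p k x∈
    ... | j , t , j<p , t<k , refl = ∈V⁺ t<k (coefficient<p t i j)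

  heffterSystem : ∀ i → HeffterSystem N k V (system i)
  heffterSystem i = Allₚ.applyUpTo⁺₁ _ p (λ {j} _ → length-applyUpTo _ k , N∣sum-block i j) , system↭V i

  orthogonal : ∀ {i i′} → i < p → i′ < p → i ≢ i′ → Orthogonal (system i) (system i′)
  orthogonal {i} {i′} i<p i′<p i≢i′ B∈ B′∈ x∈B x∈B′ y∈B y∈B′
    with ∈-applyUpTo⁻ _ B∈ | ∈-applyUpTo⁻ _ B′∈
  ... | j , _ , refl | j′ , _ , refl with block-meet x∈B x∈B′ | block-meet y∈B y∈B′
  ... | t , t<k , refl , ct | u , u<k , refl , cu with <-cmp t u
  ... | tri< t<u _ _ = ⊥-elim (i≢i′ (coefficients-determine-system t<u u<k i<p i′<p cu ct))
  ... | tri≈ _ refl _ = refl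
  ... | tri> _ _ u<t = ⊥-elim (i≢i′ (coefficients-determine-system u<t t<k i<p i′<p ct cu))

  block-residues : ∀ i j → map (_% m) (block i j) ≡ map (_% m) elements
  block-residues i j = begin
    map (_% m) (applyUpTo (element i j) k)                   ≡⟨ map-applyUpTo (element i j) (_% m) k ⟩
    applyUpTo (λ t → (ρ t + coefficient t i j * m) % m) k    ≡⟨ applyUpTo-cong (λ t → [m+kn]%n≡m%n (ρ t) (coefficient t i j) m) k ⟩
    applyUpTo (λ t → ρ t % m) k                              ≡⟨ map-applyUpTo ρ (_% m) k ⟨
    map (_% m) (applyUpTo ρ k)                               ≡⟨ cong (map (_% m)) applyUpTo-ρ ⟩
    map (_% m) elements                                      ∎
    where open ≡-Reasoning

  block-simple : ∀ i j → SimpleBlock N (block i j)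
  block-simple i j = block i j , ↭-refl , AllPairs.map (λ {a} {b} a≢b N∣ → a≢b (M.Cong⇒≈ {a} {b} (∣-trans m∣N N∣)))
    (AllPairsₚ.map⁻ (subst (AllPairs _≢_) (sym (M.partialSums-mod (block i j) elements (block-residues i j)))
                                          (AllPairsₚ.map⁺ distinct-partial-sums)))
    where module M = Modular m

  heffterSpace : SimpleCyclicRelHeffterSpace p k p p
  heffterSpace = V , halfSet , system ∘ toℕ , heffterSystem ∘ toℕ ,
    (λ i i′ i≢i′ → orthogonal (toℕ<n i) (toℕ<n i′) (i≢i′ ∘ toℕ-injective)) ,
    (λ i → Allₚ.applyUpTo⁺₁ _ p (λ {j} _ → block-simple (toℕ i) j))

data Direction : Set where
  up down : Direction

opposite : Direction → Direction
opposite up = down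
opposite down = up

move : Direction → ℕ → ℕ → ℕ
move up x g = x + g
move down x g = x ∸ g

positions : Direction → ℕ → List ℕ → List ℕ
positions d x [] = []
positions d x (g ∷ gs) = move d x g ∷ positions (opposite d) (move d x g) gs

endpoint : Direction → ℕ → List ℕ → ℕ
endpoint d x [] = x
endpoint d x (g ∷ gs) = endpoint (opposite d) (move d x g) gs

Within : ℕ → ℕ → List ℕ → Set
Within lo hi = All (λ y → lo < y × y < hi)

Within-weaken : ∀ {lo hi lo′ hi′ ys} → lo′ ≤ lo → hi ≤ hi′ → Within lo hi ys → Within lo′ hi′ ys
Within-weaken lo′≤lo hi≤hi′ = All.map λ (lo<y , y<hi) → ≤-<-trans lo′≤lo lo<y , <-≤-trans y<hi hi≤hi′

Within⇒≢lo : ∀ {lo hi ys} → Within lo hi ys → All (lo ≢_) ys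
Within⇒≢lo = All.map λ (lo<y , _) → <⇒≢ lo<y

Within⇒≢hi : ∀ {lo hi ys} → Within lo hi ys → All (hi ≢_) ys
Within⇒≢hi = All.map λ (_ , y<hi) hi≡y → <⇒≢ y<hi (sym hi≡y)

zigzag-up : ∀ lo w {gs} → Linked _>_ (w ∷ gs) → All (0 <_) gs →
  Within lo (lo + w) (positions up lo gs) × AllPairs _≢_ (positions up lo gs)
zigzag-down : ∀ lo w {gs} → Linked _>_ (w ∷ gs) → All (0 <_) gs →
  Within lo (lo + w) (positions down (lo + w) gs) × AllPairs _≢_ (positions down (lo + w) gs)

zigzag-up lo w [-] [] = [] , []
zigzag-up lo w {g ∷ _} (w>g ∷ linked) (0<g ∷ positive) with zigzag-down lo g linked positive
... | within , distinct =
  (m<m+n lo 0<g , +-monoʳ-< lo w>g) ∷ Within-weaken ≤-refl (+-monoʳ-≤ lo (<⇒≤ w>g)) within ,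
  Within⇒≢hi within ∷ distinct

zigzag-down lo w [-] [] = [] , []
zigzag-down lo w {g ∷ _} (w>g ∷ linked) (0<g ∷ positive) with zigzag-up (lo + w ∸ g) g linked positive
... | within , distinct =
  (lo<y , y<lo+w) ∷ Within-weaken (<⇒≤ lo<y) (≤-reflexive y+g≡lo+w) within ,
  Within⇒≢lo within ∷ distinct
  where
  g≤lo+w : g ≤ lo + w
  g≤lo+w = ≤-trans (<⇒≤ w>g) (m≤n+m w lo)
  lo<y : lo < lo + w ∸ g
  lo<y = m+n≤o⇒m≤o∸n (suc lo) (+-monoʳ-< lo w>g)
  y<lo+w : lo + w ∸ g < lo + w
  y<lo+w = ∸-monoʳ-< 0<g g≤lo+w
  y+g≡lo+w : lo + w ∸ g + g ≡ lo + w
  y+g≡lo+w = m∸n+n≡m g≤lo+w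

module _ (m : ℕ) .{{_ : NonZero m}} where

  signed : Direction → ℕ → ℕ
  signed up g = g
  signed down g = m ∸ g

  signedSteps : Direction → List ℕ → List ℕ
  signedSteps d [] = []
  signedSteps d (g ∷ gs) = signed d g ∷ signedSteps (opposite d) gs

  private
    step-up : ∀ {acc x g} → acc % m ≡ x → x + g < m → (acc + g) % m ≡ x + g
    step-up {acc} {x} {g} acc≡x x+g<m = begin
      (acc + g) % m ≡⟨ Modular.+-cong m {acc} {x} {g} {g} (trans acc≡x (sym (m<n⇒m%n≡m (≤-<-trans (m≤m+n x g) x+g<m)))) refl ⟩
      (x + g) % m   ≡⟨ m<n⇒m%n≡m x+g<m ⟩
      x + g         ∎
      where open ≡-Reasoning

    step-down : ∀ {acc x g} → acc % m ≡ x → g ≤ x → x < m → (acc + (m ∸ g)) % m ≡ x ∸ g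
    step-down {acc} {x} {g} acc≡x g≤x x<m = begin
      (acc + (m ∸ g)) % m ≡⟨ Modular.+-cong m {acc} {x} {m ∸ g} {m ∸ g} (trans acc≡x (sym (m<n⇒m%n≡m x<m))) refl ⟩
      (x + (m ∸ g)) % m   ≡⟨ cong (_% m) x+[m∸g]≡x∸g+m ⟩
      (x ∸ g + m) % m     ≡⟨ [m+n]%n≡m%n (x ∸ g) m ⟩
      (x ∸ g) % m         ≡⟨ m<n⇒m%n≡m (≤-<-trans (m∸n≤m x g) x<m) ⟩
      x ∸ g               ∎
      where
      open ≡-Reasoning
      x+[m∸g]≡x∸g+m : x + (m ∸ g) ≡ x ∸ g + m
      x+[m∸g]≡x∸g+m = begin
        x + (m ∸ g)       ≡⟨ +-∸-assoc x (≤-trans g≤x (<⇒≤ x<m)) ⟨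
        x + m ∸ g         ≡⟨ +-∸-comm m g≤x ⟩
        x ∸ g + m         ∎

  reduce-up : ∀ {acc lo w gs} → lo + w ≤ m → Linked _>_ (w ∷ gs) → acc % m ≡ lo →
    map (_% m) (partialSumsFrom acc (signedSteps up gs)) ≡ positions up lo gs ×
    (acc + sum (signedSteps up gs)) % m ≡ endpoint up lo gs
  reduce-down : ∀ {acc lo w gs} → lo + w < m → Linked _>_ (w ∷ gs) → acc % m ≡ lo + w →
    map (_% m) (partialSumsFrom acc (signedSteps down gs)) ≡ positions down (lo + w) gs ×
    (acc + sum (signedSteps down gs)) % m ≡ endpoint down (lo + w) gs

  reduce-up {acc} {gs = []} _ _ acc≡lo = refl , trans (cong (_% m) (+-identityʳ acc)) acc≡lo
  reduce-up {acc} {lo} {w} {g ∷ gs} lo+w≤m (w>g ∷ linked) acc≡lo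
    with step ← step-up acc≡lo (<-≤-trans (+-monoʳ-< lo w>g) lo+w≤m)
    with partial , total ← reduce-down (<-≤-trans (+-monoʳ-< lo w>g) lo+w≤m) linked step =
    cong₂ _∷_ step partial , trans (cong (_% m) (sym (+-assoc acc g _))) total

  reduce-down {acc} {gs = []} _ _ acc≡lo+w = refl , trans (cong (_% m) (+-identityʳ acc)) acc≡lo+w
  reduce-down {acc} {lo} {w} {g ∷ gs} lo+w<m (w>g ∷ linked) acc≡lo+w
    with step ← step-down acc≡lo+w (≤-trans (<⇒≤ w>g) (m≤n+m w lo)) lo+w<m
    with partial , total ← reduce-up (≤-trans (≤-reflexive (m∸n+n≡m (≤-trans (<⇒≤ w>g) (m≤n+m w lo)))) (<⇒≤ lo+w<m)) linked step =
    cong₂ _∷_ step partial , trans (cong (_% m) (sym (+-assoc acc (m ∸ g) _))) total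

module _ {m : ℕ} where

  Signs : List ℕ → List ℕ → Set
  Signs = Pointwise λ g r → r ≡± g mod m

  signs-range : ∀ {gs rs} → Signs gs rs → All (λ g → 0 < g × g < m) gs → All (λ r → 0 < r × r < m) rs
  signs-range = Pointwise⇒All λ r≡±g (0<g , g<m) → ≡±-range 0<g g<m r≡±g

  signs-unique : ∀ {gs rs} → Signs gs rs → AllPairs (λ g g′ → g ≢ g′ × g + g′ ≢ m) gs → Unique rs
  signs-unique [] [] = []
  signs-unique (r≡±g ∷ rs≡±gs) (g-apart ∷ gs-apart) =
    Pointwise⇒All (λ r′≡±g′ (g≢g′ , g+g′≢m) → ≡±-distinct g≢g′ g+g′≢m r≡±g r′≡±g′) rs≡±gs g-apart ∷
    signs-unique rs≡±gs gs-apart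

  signs-cover : ∀ {gs rs g} → Signs gs rs → g ∈ gs → ∃ λ r → r ∈ rs × r ≡± g mod m
  signs-cover (r≡±g ∷ _) (here refl) = _ , here refl , r≡±g
  signs-cover (_ ∷ rs≡±gs) (there g∈gs) with signs-cover rs≡±gs g∈gs
  ... | r , r∈rs , r≡±g = r , there r∈rs , r≡±g

  signedSteps-signs : ∀ .{{_ : NonZero m}} d {gs} → All (_≤ m) gs → Signs gs (signedSteps m d gs)
  signedSteps-signs d [] = []
  signedSteps-signs up (_ ∷ gs≤m) = inj₁ refl ∷ signedSteps-signs down gs≤m
  signedSteps-signs down (g≤m ∷ gs≤m) = inj₂ (m∸n+n≡m g≤m) ∷ signedSteps-signs up gs≤m

-- h ∷ T holds one representative of each pair {v, −v} of nonzero residues modulo 2k + 1.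
module RepresentativesOf {k h : ℕ} {T : List ℕ} (h≡k⊎1+k : h ≡ k ⊎ h ≡ suc k)
  (T-range : All (λ g → 0 < g × g < k) T) (T-unique : AllPairs _≢_ T) (T-cover : ∀ {v} → 0 < v → v < k → v ∈ T) where

  private
    m : ℕ
    m = oddOrder k

  k≤h : k ≤ h
  k≤h = [ (λ h≡k → ≤-reflexive (sym h≡k)) , (λ h≡1+k → ≤-trans (n≤1+n k) (≤-reflexive (sym h≡1+k))) ]′ h≡k⊎1+k

  private
    h≤1+k : h ≤ suc k
    h≤1+k = [ (λ h≡k → ≤-trans (≤-reflexive h≡k) (n≤1+n k)) , ≤-reflexive ]′ h≡k⊎1+k

    <k+≤1+k⇒<m : ∀ {x y} → x < k → y ≤ suc k → x + y < m
    <k+≤1+k⇒<m {x} {y} x<k y≤1+k = subst (suc (x + y) ≤_) (+-suc k k) (+-mono-≤ x<k y≤1+k)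

  range : 0 < k → All (λ g → 0 < g × g < m) (h ∷ T)
  range 0<k =
    (<-≤-trans 0<k k≤h , s≤s (≤-trans h≤1+k (+-monoˡ-≤ k 0<k))) ∷
    All.map (λ (0<g , g<k) → 0<g , <-trans g<k (s≤s (m≤m+n k k))) T-range

  apart : AllPairs (λ g g′ → g ≢ g′ × g + g′ ≢ m) (h ∷ T)
  apart =
    All.map (λ (_ , g<k) → (λ h≡g → <⇒≢ (<-≤-trans g<k k≤h) (sym h≡g)) ,
                           (λ h+g≡m → <⇒≢ (<k+≤1+k⇒<m g<k h≤1+k) (trans (+-comm _ h) h+g≡m))) T-range ∷
    AllPairs.zip (T-unique , All⇒AllPairs (λ (_ , g<k) (_ , g′<k) → <⇒≢ (<k+≤1+k⇒<m g<k (≤-trans (<⇒≤ g′<k) (n≤1+n k)))) T-range)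

  private
    cover-≤k : ∀ {v} → 0 < v → v ≤ k → ∃ λ g → g ∈ h ∷ T × g ≡± v mod m
    cover-≤k {v} 0<v v≤k with m≤n⇒m<n∨m≡n v≤k
    ... | inj₁ v<k = v , there (T-cover 0<v v<k) , inj₁ refl
    ... | inj₂ refl = h , here refl , Sum.map₂ (cong (_+ k)) h≡k⊎1+k

  cover : ∀ {v} → 0 < v → v < m → ∃ λ g → g ∈ h ∷ T × g ≡± v mod m
  cover {v} 0<v v<m with v ≤? k
  ... | yes v≤k = cover-≤k 0<v v≤k
  ... | no v≰k with cover-≤k (m<n⇒0<n∸m v<m) (≤-trans (∸-monoʳ-≤ m (≰⇒> v≰k)) (≤-reflexive (m+n∸n≡m k k)))
  ...   | g , g∈ , g≡±m∸v = g , g∈ , ≡±-trans g≡±m∸v (inj₂ (m∸n+n≡m (<⇒≤ v<m)))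

run : ℕ → ℕ → List ℕ
run n s = applyDownFrom (s +_) n

run-range : ∀ n s → All (λ g → s ≤ g × g < s + n) (run n s)
run-range n s = Allₚ.applyDownFrom⁺₁ (s +_) n λ i<n → m≤m+n s _ , +-monoʳ-< s i<n

∈-run : ∀ {n s v} → s ≤ v → v < s + n → v ∈ run n s
∈-run {n} {s} {v} s≤v v<s+n = Anyₚ.applyDownFrom⁺ (s +_) (sym (m+[n∸m]≡n s≤v))
  (+-cancelˡ-< s _ _ (subst (_< s + n) (sym (m+[n∸m]≡n s≤v)) v<s+n))

run-decreasing : ∀ n s → AllPairs _>_ (run n s)
run-decreasing n s = AllPairsₚ.applyDownFrom⁺₁ (s +_) n λ j<i _ → +-monoʳ-< s j<i

-- With c = b + 1: h, then c + a, …, c + 1 and b, …, 1; the missing c is the closing step.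
gaps : ℕ → ℕ → ℕ → List ℕ
gaps h a b = h ∷ run a (suc (suc b)) ++ run b 1

record ZigzagShape (k : ℕ) : Set where
  field
    h a b : ℕ
    h≡k⊎1+k : h ≡ k ⊎ h ≡ suc k
    k≡a+2+b : k ≡ a + suc (suc b)
    endpoint≡1+b : endpoint up 0 (gaps h a b) ≡ suc b

module FromShape {k : ℕ} (S : ZigzagShape k) where

  open ZigzagShape S

  m c : ℕ
  m = oddOrder k
  c = suc b

  middle : List ℕ
  middle = run a (suc c) ++ run b 1

  k≡1+c+a : k ≡ suc c + a
  k≡1+c+a = trans k≡a+2+b (+-comm a (suc c))

  c<k : c < k
  c<k = subst (c <_) (sym k≡1+c+a) (s≤s (m≤m+n c a))

  middle-range : All (λ g → 0 < g × g < k) middle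
  middle-range = Allₚ.++⁺
    (All.map (λ (1+c≤g , g<1+c+a) → <-≤-trans (s≤s z≤n) 1+c≤g , subst (_ <_) (sym k≡1+c+a) g<1+c+a) (run-range a (suc c)))
    (All.map (λ (1≤g , g<1+b) → 1≤g , <-trans g<1+b c<k) (run-range b 1))

  middle-decreasing : AllPairs _>_ middle
  middle-decreasing = AllPairsₚ.++⁺ (run-decreasing a (suc c)) (run-decreasing b 1)
    (All.map (λ (1+c≤x , _) → All.map (λ (_ , y<c) → <-≤-trans y<c (≤-trans (n≤1+n c) 1+c≤x)) (run-range b 1)) (run-range a (suc c)))

  tail : List ℕ
  tail = middle ∷ʳ c

  tail-range : All (λ g → 0 < g × g < k) tail
  tail-range = Allₚ.++⁺ middle-range ((s≤s z≤n , c<k) ∷ [])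

  tail-unique : AllPairs _≢_ tail
  tail-unique = AllPairsₚ.++⁺ (AllPairs.map (λ x>y → ≢-sym (<⇒≢ x>y)) middle-decreasing) ([] ∷ [])
    (Allₚ.++⁺ (All.map (λ (1+c≤x , _) → (λ x≡c → <⇒≢ 1+c≤x (sym x≡c)) ∷ []) (run-range a (suc c)))
              (All.map (λ (_ , x<c) → <⇒≢ x<c ∷ []) (run-range b 1)))

  tail-cover : ∀ {v} → 0 < v → v < k → v ∈ tail
  tail-cover {v} 0<v v<k with <-cmp v c
  ... | tri< v<c _ _ = ∈-++⁺ˡ (∈-++⁺ʳ (run a (suc c)) (∈-run 0<v v<c))
  ... | tri≈ _ refl _ = ∈-++⁺ʳ middle (here refl)
  ... | tri> _ _ c<v = ∈-++⁺ˡ (∈-++⁺ˡ (∈-run c<v (subst (v <_) k≡1+c+a v<k)))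

  0<k : 0 < k
  0<k = <-trans (s≤s z≤n) c<k

  module Representatives = RepresentativesOf h≡k⊎1+k tail-range tail-unique tail-cover

  c<m : c < m
  c<m = <-trans c<k (s≤s (m≤m+n k k))

  gaps-range : All (λ g → 0 < g × g < m) (gaps h a b)
  gaps-range = Allₚ.++⁻ˡ (h ∷ middle) (Representatives.range 0<k)

  gaps-linked : Linked _>_ (m ∷ gaps h a b)
  gaps-linked = AllPairs⇒Linked (All.map proj₂ gaps-range ∷ h>middle ∷ middle-decreasing)
    where
    h>middle : All (h >_) middle
    h>middle = All.map (λ (_ , g<k) → <-≤-trans g<k Representatives.k≤h) middle-range

  steps ρs : List ℕ
  steps = signedSteps m up (gaps h a b)
  ρs = steps ∷ʳ (m ∸ c)

  ρs-signs : Signs (h ∷ tail) ρs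
  ρs-signs = Pointwise.++⁺ (signedSteps-signs up (All.map (<⇒≤ ∘ proj₂) gaps-range)) (inj₂ (m∸n+n≡m (<⇒≤ c<m)) ∷ [])

  length-ρs : length ρs ≡ k
  length-ρs = begin
    length ρs                                     ≡⟨ Pointwise-length ρs-signs ⟨
    suc (length (middle ∷ʳ c))                    ≡⟨ cong suc (length-++ middle) ⟩
    suc (length middle + 1)                       ≡⟨ cong (λ n → suc (n + 1)) (length-++ (run a (suc c))) ⟩
    suc (length (run a (suc c)) + length (run b 1) + 1) ≡⟨ cong₂ (λ x y → suc (x + y + 1)) (length-applyDownFrom _ a) (length-applyDownFrom _ b) ⟩
    suc (a + b + 1)                               ≡⟨ rearrange a b ⟩
    a + suc (suc b)                               ≡⟨ k≡a+2+b ⟨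
    k                                             ∎
    where
    open ≡-Reasoning
    rearrange : ∀ a b → suc (a + b + 1) ≡ a + suc (suc b)
    rearrange = solve-∀

  walk : Within 0 m (positions up 0 (gaps h a b)) × AllPairs _≢_ (positions up 0 (gaps h a b))
  walk = zigzag-up 0 m gaps-linked (All.map proj₁ gaps-range)

  walk-mod-m : map (_% m) (partialSumsFrom 0 steps) ≡ positions up 0 (gaps h a b) × sum steps % m ≡ c
  walk-mod-m with partial , total ← reduce-up m {0} {0} {m} ≤-refl gaps-linked refl = partial , trans total endpoint≡1+b

  closing-step : (sum steps + (m ∸ c)) % m ≡ 0
  closing-step = begin
    (sum steps + (m ∸ c)) % m ≡⟨ Modular.+-cong m {sum steps} {c} {m ∸ c} {m ∸ c} (trans (proj₂ walk-mod-m) (sym (m<n⇒m%n≡m c<m))) refl ⟩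
    (c + (m ∸ c)) % m         ≡⟨ cong (_% m) (m+[n∸m]≡n (<⇒≤ c<m)) ⟩
    m % m                     ≡⟨ n%n≡0 m ⟩
    0                         ∎
    where open ≡-Reasoning

  ρs-residues : map (_% m) (partialSums ρs) ≡ positions up 0 (gaps h a b) ∷ʳ 0
  ρs-residues = begin
    map (_% m) (partialSums ρs)                                         ≡⟨ cong (map (_% m)) (partialSums≡partialSumsFrom0 ρs) ⟩
    map (_% m) (partialSumsFrom 0 (steps ∷ʳ (m ∸ c)))                   ≡⟨ cong (map (_% m)) (partialSumsFrom-++ 0 steps (m ∸ c ∷ [])) ⟩
    map (_% m) (partialSumsFrom 0 steps ∷ʳ (sum steps + (m ∸ c)))       ≡⟨ map-++ (_% m) (partialSumsFrom 0 steps) _ ⟩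
    map (_% m) (partialSumsFrom 0 steps) ∷ʳ (sum steps + (m ∸ c)) % m   ≡⟨ cong₂ _∷ʳ_ (proj₁ walk-mod-m) closing-step ⟩
    positions up 0 (gaps h a b) ∷ʳ 0                                    ∎
    where open ≡-Reasoning

  sum-ρs%m≡0 : sum ρs % m ≡ 0
  sum-ρs%m≡0 = begin
    sum ρs % m                    ≡⟨ cong (_% m) (sum-++ steps (m ∸ c ∷ [])) ⟩
    (sum steps + (m ∸ c + 0)) % m ≡⟨ cong (λ x → (sum steps + x) % m) (+-identityʳ (m ∸ c)) ⟩
    (sum steps + (m ∸ c)) % m     ≡⟨ closing-step ⟩
    0                             ∎
    where open ≡-Reasoning

  distinct-residues : AllPairs _≢_ (positions up 0 (gaps h a b) ∷ʳ 0)
  distinct-residues = AllPairsₚ.++⁺ (proj₂ walk) ([] ∷ []) (All.map (λ (0<y , _) → ≢-sym (<⇒≢ 0<y) ∷ []) (proj₁ walk))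

  simpleZeroSumHalfSet : SimpleZeroSumHalfSet k
  simpleZeroSumHalfSet = record
    { elements = ρs
    ; length-elements = length-ρs
    ; elements-range = signs-range ρs-signs (Representatives.range 0<k)
    ; elements-unique = signs-unique ρs-signs Representatives.apart
    ; elements-cover = cover
    ; zero-sum = m%n≡0⇒n∣m (sum ρs) m sum-ρs%m≡0
    ; distinct-partial-sums = AllPairsₚ.map⁻ (subst (AllPairs _≢_) (sym ρs-residues) distinct-residues)
    }
    where
    cover : ∀ {v} → 0 < v → v < m → ∃ λ r → r ∈ ρs × r ≡± v mod m
    cover 0<v v<m with Representatives.cover 0<v v<m
    ... | g , g∈ , g≡±v with signs-cover ρs-signs g∈
    ... | r , r∈ , r≡±g = r , r∈ , ≡±-trans r≡±g g≡±v

endpoint-up-run : ∀ j s x ys → endpoint up x (run (j * 2) s ++ ys) ≡ endpoint up (x + j) ys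
endpoint-up-run zero s x ys = cong (λ y → endpoint up y ys) (sym (+-identityʳ x))
endpoint-up-run (suc j) s x ys = begin
  endpoint up (x + (s + suc (j * 2)) ∸ (s + j * 2)) (run (j * 2) s ++ ys) ≡⟨ cong (λ y → endpoint up y (run (j * 2) s ++ ys)) up-down ⟩
  endpoint up (suc x) (run (j * 2) s ++ ys)                               ≡⟨ endpoint-up-run j s (suc x) ys ⟩
  endpoint up (suc x + j) ys                                              ≡⟨ cong (λ y → endpoint up y ys) (+-suc x j) ⟨
  endpoint up (x + suc j) ys                                              ∎
  where
  open ≡-Reasoning
  up-down : x + (s + suc (j * 2)) ∸ (s + j * 2) ≡ suc x
  up-down = trans (cong (_∸ (s + j * 2)) (rearrange x s (j * 2))) (m+n∸n≡m (suc x) (s + j * 2))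
    where
    rearrange : ∀ x s J → x + (s + suc J) ≡ suc x + (s + J)
    rearrange = solve-∀

endpoint-down-run : ∀ j s x ys → s + j ≤ suc x → endpoint down (x + j) (run (j * 2) s ++ ys) ≡ endpoint down x ys
endpoint-down-run zero s x ys _ = cong (λ y → endpoint down y ys) (+-identityʳ x)
endpoint-down-run (suc j) s x ys s+1+j≤1+x = begin
  endpoint down (x + suc j ∸ (s + suc (j * 2)) + (s + j * 2)) (run (j * 2) s ++ ys) ≡⟨ cong (λ y → endpoint down y (run (j * 2) s ++ ys)) down-up ⟩
  endpoint down (x + j) (run (j * 2) s ++ ys)                                       ≡⟨ endpoint-down-run j s x ys (≤-trans (+-monoʳ-≤ s (n≤1+n j)) s+1+j≤1+x) ⟩
  endpoint down x ys                                                                ∎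
  where
  open ≡-Reasoning
  s+2j≤x+j : s + j * 2 ≤ x + j
  s+2j≤x+j = subst (_≤ x + j) (rearrange s j) (+-monoˡ-≤ j (≤-pred (subst (_≤ suc x) (+-suc s j) s+1+j≤1+x)))
    where
    rearrange : ∀ s j → s + j + j ≡ s + j * 2
    rearrange = solve-∀
  down-up : x + suc j ∸ (s + suc (j * 2)) + (s + j * 2) ≡ x + j
  down-up = begin
    x + suc j ∸ (s + suc (j * 2)) + (s + j * 2) ≡⟨ cong₂ (λ u v → u ∸ v + (s + j * 2)) (+-suc x j) (+-suc s (j * 2)) ⟩
    x + j ∸ (s + j * 2) + (s + j * 2)           ≡⟨ m∸n+n≡m s+2j≤x+j ⟩
    x + j                                       ∎

private
  +≤1 : ∀ {k δ} → δ ≤ 1 → k + δ ≡ k ⊎ k + δ ≡ suc k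
  +≤1 {k} z≤n = inj₁ (+-identityʳ k)
  +≤1 {k} (s≤s z≤n) = inj₂ (+-comm k 1)

  2+n+n≡2+n*2 : ∀ n → 2 + n + n ≡ 2 + n * 2
  2+n+n≡2+n*2 = solve-∀

evenShape : ∀ α δ → δ ≤ 1 → ZigzagShape (3 + δ * 2 + α * 4)
evenShape α δ δ≤1 = record
  { h = k + δ
  ; a = α * 2
  ; b = suc (β * 2)
  ; h≡k⊎1+k = +≤1 δ≤1
  ; k≡a+2+b = k≡a+2+b′ α δ
  ; endpoint≡1+b = begin
      endpoint down (k + δ) (run (α * 2) s ++ B)  ≡⟨ cong (λ y → endpoint down y (run (α * 2) s ++ B)) h≡X+α ⟩
      endpoint down (X + α) (run (α * 2) s ++ B)  ≡⟨ endpoint-down-run α s X B s+α≤1+X ⟩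
      endpoint up (X ∸ suc (β * 2)) (run (β * 2) 1) ≡⟨ cong₂ (endpoint up) X∸[1+2β]≡2+β (sym (++-identityʳ (run (β * 2) 1))) ⟩
      endpoint up (2 + β) (run (β * 2) 1 ++ [])   ≡⟨ endpoint-up-run β 1 (2 + β) [] ⟩
      2 + β + β                                    ≡⟨ 2+n+n≡2+n*2 β ⟩
      2 + β * 2                                    ∎
  }
  where
  open ≡-Reasoning
  k β s X : ℕ
  k = 3 + δ * 2 + α * 4
  β = α + δ
  s = 3 + β * 2
  X = 3 + β * 3
  B : List ℕ
  B = run (suc (β * 2)) 1
  k≡a+2+b′ : ∀ α δ → 3 + δ * 2 + α * 4 ≡ α * 2 + (3 + (α + δ) * 2)
  k≡a+2+b′ = solve-∀
  h≡X+α′ : ∀ α δ → 3 + δ * 2 + α * 4 + δ ≡ 3 + (α + δ) * 3 + α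
  h≡X+α′ = solve-∀
  s+α+1+δ≡1+X : ∀ α δ → 3 + (α + δ) * 2 + α + (1 + δ) ≡ 4 + (α + δ) * 3
  s+α+1+δ≡1+X = solve-∀
  X≡2+β+[1+2β] : ∀ β → 3 + β * 3 ≡ 2 + β + (1 + β * 2)
  X≡2+β+[1+2β] = solve-∀
  h≡X+α : k + δ ≡ X + α
  h≡X+α = h≡X+α′ α δ
  s+α≤1+X : s + α ≤ suc X
  s+α≤1+X = subst (s + α ≤_) (s+α+1+δ≡1+X α δ) (m≤m+n (s + α) (1 + δ))
  X∸[1+2β]≡2+β : X ∸ suc (β * 2) ≡ 2 + β
  X∸[1+2β]≡2+β = trans (cong (_∸ suc (β * 2)) (X≡2+β+[1+2β] β)) (m+n∸n≡m (2 + β) (suc (β * 2)))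

oddShape : ∀ α δ → δ ≤ 1 → ZigzagShape (4 + δ * 2 + α * 4)
oddShape α δ δ≤1 = record
  { h = k + δ
  ; a = suc (α * 2)
  ; b = suc (β * 2)
  ; h≡k⊎1+k = +≤1 δ≤1
  ; k≡a+2+b = k≡a+2+b′ α δ
  ; endpoint≡1+b = begin
      endpoint up (k + δ ∸ (s + α * 2)) (run (α * 2) s ++ B) ≡⟨ cong (λ y → endpoint up y (run (α * 2) s ++ B)) h∸[s+2α]≡1+δ ⟩
      endpoint up (suc δ) (run (α * 2) s ++ B)                ≡⟨ endpoint-up-run α s (suc δ) B ⟩
      endpoint down (suc δ + α + suc (β * 2)) (run (β * 2) 1) ≡⟨ cong₂ (endpoint down) turn (sym (++-identityʳ (run (β * 2) 1))) ⟩
      endpoint down (2 + β * 2 + β) (run (β * 2) 1 ++ [])     ≡⟨ endpoint-down-run β 1 (2 + β * 2) [] 1+β≤3+2β ⟩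
      2 + β * 2                                               ∎
  }
  where
  open ≡-Reasoning
  k β s : ℕ
  k = 4 + δ * 2 + α * 4
  β = α + δ
  s = 3 + β * 2
  B : List ℕ
  B = run (suc (β * 2)) 1
  k≡a+2+b′ : ∀ α δ → 4 + δ * 2 + α * 4 ≡ suc (α * 2) + (3 + (α + δ) * 2)
  k≡a+2+b′ = solve-∀
  h≡1+δ+[s+2α] : ∀ α δ → 4 + δ * 2 + α * 4 + δ ≡ suc δ + (3 + (α + δ) * 2 + α * 2)
  h≡1+δ+[s+2α] = solve-∀
  turn′ : ∀ α δ → suc δ + α + suc ((α + δ) * 2) ≡ 2 + (α + δ) * 2 + (α + δ)
  turn′ = solve-∀
  h∸[s+2α]≡1+δ : k + δ ∸ (s + α * 2) ≡ suc δ
  h∸[s+2α]≡1+δ = trans (cong (_∸ (s + α * 2)) (h≡1+δ+[s+2α] α δ)) (m+n∸n≡m (suc δ) (s + α * 2))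
  turn : suc δ + α + suc (β * 2) ≡ 2 + β * 2 + β
  turn = turn′ α δ
  1+β≤3+2β : 1 + β ≤ suc (2 + β * 2)
  1+β≤3+2β = s≤s (subst (β ≤_) (2+n+n≡2+n*2 β) (m≤n+m β (2 + β)))

data Residue4 : ℕ → Set where
  4α+0 : ∀ α → Residue4 (α * 4)
  4α+1 : ∀ α → Residue4 (1 + α * 4)
  4α+2 : ∀ α → Residue4 (2 + α * 4)
  4α+3 : ∀ α → Residue4 (3 + α * 4)

residue4 : ∀ n → Residue4 n
residue4 0 = 4α+0 0
residue4 1 = 4α+1 0
residue4 2 = 4α+2 0
residue4 3 = 4α+3 0
residue4 (suc (suc (suc (suc n)))) with residue4 n
... | 4α+0 α = 4α+0 (suc α)
... | 4α+1 α = 4α+1 (suc α)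
... | 4α+2 α = 4α+2 (suc α)
... | 4α+3 α = 4α+3 (suc α)

zigzagShape : ∀ k → 3 ≤ k → ZigzagShape k
zigzagShape k 3≤k = subst ZigzagShape (m+[n∸m]≡n 3≤k) (shape (residue4 (k ∸ 3)))
  where
  shape : ∀ {r} → Residue4 r → ZigzagShape (3 + r)
  shape (4α+0 α) = evenShape α 0 z≤n
  shape (4α+1 α) = oddShape α 0 z≤n
  shape (4α+2 α) = evenShape α 1 (s≤s z≤n)
  shape (4α+3 α) = oddShape α 1 (s≤s z≤n)

theorem3p7 : (p k : ℕ) → Prime p → 3 ≤ p → 3 ≤ k → k ≤ p →
    SimpleCyclicRelHeffterSpace p k p p
-- 3 ≤ p is implied by 3 ≤ k ≤ p.
theorem3p7 p k p-prime _ 3≤k k≤p =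
  Lifting.heffterSpace p-prime 3≤k k≤p (FromShape.simpleZeroSumHalfSet (zigzagShape k 3≤k))
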